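{- Let $d\ge2$ and $k\in[d-1]$. There exist finite sets $\mathcal{A}_1,\dots,\mathcal{A}_{d+(d-k)}$ of nonzero vectors in $\mathbb{R}^d$ such that for each $i\in[d+(d-k)]$ the solution set of the system $\langle a,x\rangle\le0$, $a\in\mathcal{A}_i$, has dimension strictly less than $k$, but for every rainbow sub-selection $R$ from these sets the system $\langle a,x\rangle\le 0$, $a\in R$, has at least $k$ linearly independent solutions.
   Context: $[n]=\{1,\dots,n\}$. A rainbow sub-selection from sets $\mathcal{A}_1,\dots,\mathcal{A}_N$ is a set obtained by choosing at most one element from each $\mathcal{A}_j$. -}

module Defs where

open import Data.Nat using (ℕ; zero; suc)
open import Data.Fin using (Fin; zero; suc)
open import Data.Rational using (ℚ; 0ℚ; _+_; _*_; _-_; _≤_)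
open import Data.List using (List)
open import Data.List.Membership.Propositional using (_∈_)
open import Data.Maybe using (Maybe; just)
open import Data.Product using (Σ; _×_)
open import Relation.Binary.PropositionalEquality using (_≡_)
open import Relation.Nullary using (¬_)

Vecℚ : ℕ → Set
Vecℚ d = Fin d → ℚ

sumℚ : (n : ℕ) → (Fin n → ℚ) → ℚ
sumℚ zero    f = 0ℚ
sumℚ (suc n) f = f zero + sumℚ n (λ i → f (suc i))

⟨_,_⟩ : {d : ℕ} → Vecℚ d → Vecℚ d → ℚ
⟨_,_⟩ {d} a x = sumℚ d (λ i → a i * x i)

IsZeroVec : {d : ℕ} → Vecℚ d → Set
IsZeroVec {d} a = (i : Fin d) → a i ≡ 0ℚ

SolvesList : {d : ℕ} → List (Vecℚ d) → Vecℚ d → Set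
SolvesList {d} A x = (a : Vecℚ d) → a ∈ A → ⟨ a , x ⟩ ≤ 0ℚ

LinIndep : {d m : ℕ} → (Fin m → Vecℚ d) → Set
LinIndep {d} {m} v =
  (c : Fin m → ℚ) → ((j : Fin d) → sumℚ m (λ i → c i * v i j) ≡ 0ℚ) →
  (i : Fin m) → c i ≡ 0ℚ

AffIndep : {d m : ℕ} → (Fin (suc m) → Vecℚ d) → Set
AffIndep {d} {m} p = LinIndep {d} {m} (λ i j → p (suc i) j - p zero j)

-- dim S < k  iff  S contains no k+1 affinely independent points
-- (dimension of a set = dimension of its affine hull)
DimLt : {d : ℕ} → (Vecℚ d → Set) → ℕ → Set
DimLt {d} S k =
  ¬ (Σ (Fin (suc k) → Vecℚ d) λ p → ((i : Fin (suc k)) → S (p i)) × AffIndep p)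

-- a rainbow sub-selection from A_1..A_N: at most one element chosen from each A_j
IsRainbow : {d N : ℕ} → (Fin N → List (Vecℚ d)) → (Fin N → Maybe (Vecℚ d)) → Set
IsRainbow {d} {N} A sel = (j : Fin N) (a : Vecℚ d) → sel j ≡ just a → a ∈ A j

SolvesSel : {d N : ℕ} → (Fin N → Maybe (Vecℚ d)) → Vecℚ d → Set
SolvesSel {d} {N} sel x = (j : Fin N) (a : Vecℚ d) → sel j ≡ just a → ⟨ a , x ⟩ ≤ 0ℚ

{-# OPTIONS --safe #-}
-- Write k = a + 1 and d = a + m (so m = d − k + 1) and split ℚ^d = ℚ^a × ℚ^m. Take 2m − 1
-- copies of the set {(0, ±e_j)} and, for each t < a, the set {(−e_t, 0)} ∪ {(e_t, ±e_j)}: these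
-- are d + (d − k) sets. Each of these systems forces the last m coordinates to vanish (for the
-- second kind add (e_t, ±e_j) and (−e_t, 0)), so its solutions have dimension at most a < k.
-- A rainbow selection takes at most 2m − 1 of the 2m vectors ±e_j offered by the first kind of
-- sets, so it misses one of them, w, and ⟨±e_j, w⟩ ≤ 0 for every other one. Choosing σ_t = ±1
-- opposite to the e_t-coefficient of the vector selected from the t-th set of the second kind,
-- the k vectors (σ, w) and (σ_t e_t, 0) solve the selected system and are linearly independent.

module Submission where

open import Defs
open import Data.Empty using (⊥-elim)
open import Data.Fin using (Fin; zero; suc; _↑ˡ_; _↑ʳ_; punchIn; _≟_)
open import Data.Fin.Properties using (punchInᵢ≢i; any?; all?; ¬∀⟶∃¬; injective⇒≤)
open import Data.List using (List; map; allFin)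
open import Data.List.Membership.Propositional using (_∈_)
open import Data.List.Membership.Propositional.Properties using (∈-map⁺; ∈-map⁻; ∈-allFin)
open import Data.List.Relation.Unary.All as All using (All)
open import Data.List.Relation.Unary.All.Properties using (map⁺)
open import Data.Maybe using (Maybe; just; nothing; maybe)
open import Data.Maybe.Properties using (just-injective) renaming (≡-dec to ≡-decᴹ)
open import Data.Nat as ℕ using (ℕ; zero; suc)
import Data.Nat.Properties as ℕₚ
open import Data.Product using (Σ; ∃; _×_; _,_; proj₁; proj₂)
open import Data.Sum using (_⊎_; inj₁; inj₂)
open import Data.Unit using (tt)
open import Data.Vec.Functional using (_++_; removeAt; insertAt)
open import Data.Vec.Functional.Properties
  using (lookup-++ˡ; lookup-++ʳ; insertAt-lookup; insertAt-punchIn; removeAt-insertAt)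
open import Function using (_∘_; id)
open import Function.Definitions using (Injective)
open import Relation.Binary.Definitions using (DecidableEquality)
open import Relation.Binary.PropositionalEquality
open import Relation.Nullary using (¬_; Dec; yes; no; ¬?)
open import Relation.Nullary.Decidable using (decidable-stable)

data SplitView (m n : ℕ) : Fin (m ℕ.+ n) → Set where
  inl : (i : Fin m) → SplitView m n (i ↑ˡ n)
  inr : (j : Fin n) → SplitView m n (m ↑ʳ j)

splitView : ∀ m n (i : Fin (m ℕ.+ n)) → SplitView m n i
splitView zero    n j       = inr j
splitView (suc m) n zero    = inl zero
splitView (suc m) n (suc i) with splitView m n i
... | inl i′ = inl (suc i′)
... | inr j  = inr j

_≟ᴹ_ : ∀ {n} → DecidableEquality (Maybe (Fin n))
_≟ᴹ_ = ≡-decᴹ _≟_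

unusedLabel : ∀ {n L} → n ℕ.< L → (κ : Fin n → Maybe (Fin L)) →
  Σ (Fin L) λ ℓ → ∀ i → κ i ≢ just ℓ
unusedLabel {n} n<L κ with any? (λ ℓ → all? (λ i → ¬? (κ i ≟ᴹ just ℓ)))
... | yes unused = unused
... | no  none   = ⊥-elim (ℕₚ.<⇒≱ n<L (injective⇒≤ hit-injective))
  where
  hit : ∀ ℓ → Σ (Fin n) λ i → κ i ≡ just ℓ
  hit ℓ with ¬∀⟶∃¬ n _ (λ i → ¬? (κ i ≟ᴹ just ℓ)) (λ all≢ → none (ℓ , all≢))
  ... | i , ¬≢ = i , decidable-stable (κ i ≟ᴹ just ℓ) ¬≢
  hit-injective : Injective _≡_ _≡_ (proj₁ ∘ hit)
  hit-injective {ℓ} {ℓ′} same =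
    just-injective (trans (sym (proj₂ (hit ℓ))) (trans (cong κ same) (proj₂ (hit ℓ′))))

module _ {A B : Set} (f : B → A) (xs : List B) where

  maybePreimage : (ms : Maybe A) → (∀ v → ms ≡ just v → v ∈ map f xs) → Maybe B
  maybePreimage nothing  _   = nothing
  maybePreimage (just v) ms⊆ = just (proj₁ (∈-map⁻ f (ms⊆ v refl)))

  maybePreimage-spec : ∀ ms (ms⊆ : ∀ v → ms ≡ just v → v ∈ map f xs) v → ms ≡ just v →
    ∃ λ b → maybePreimage ms ms⊆ ≡ just b × v ≡ f b
  maybePreimage-spec (just v) ms⊆ .v refl = _ , refl , proj₂ (proj₂ (∈-map⁻ f (ms⊆ v refl)))

RainbowGapFamily : ℕ → ℕ → ℕ → Set
RainbowGapFamily d k N = Σ (Fin N → List (Vecℚ d)) λ A →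
  ((i : Fin N) → All (λ a → ¬ IsZeroVec a) (A i))
  × ((i : Fin N) → DimLt (SolvesList (A i)) k)
  × ((sel : Fin N → Maybe (Vecℚ d)) → IsRainbow A sel →
       Σ (Fin k → Vecℚ d) λ v → LinIndep v × ((i : Fin k) → SolvesSel sel (v i)))

module LinearAlgebra where

  open import Data.Rational using (ℚ; 0ℚ; 1ℚ; _+_; _*_; _-_; -_; _≤_; 1/_; ≢-nonZero)
  open import Data.Rational.Properties
    using ( +-identityˡ; +-assoc; *-comm; *-assoc; *-zeroˡ; *-zeroʳ; *-identityˡ; *-identityʳ
          ; *-inverseˡ; ≤-antisym; neg-antimono-≤; ≤ᵇ⇒≤; 1≢0; +-*-ring)
    renaming (_≟_ to _≟ℚ_)
  open import Data.Rational.Solver using (module +-*-Solver)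
  open +-*-Solver
  open ≡-Reasoning
  open import Algebra.Bundles using (Ring)
  open import Algebra.Properties.Semiring.Sum (Ring.semiring +-*-ring) using (sum; sum-remove)

  sumℚ-cong : ∀ n {f g : Fin n → ℚ} → f ≗ g → sumℚ n f ≡ sumℚ n g
  sumℚ-cong zero    f≗g = refl
  sumℚ-cong (suc n) f≗g = cong₂ _+_ (f≗g zero) (sumℚ-cong n (f≗g ∘ suc))

  sumℚ-zero : ∀ n {f : Fin n → ℚ} → (∀ i → f i ≡ 0ℚ) → sumℚ n f ≡ 0ℚ
  sumℚ-zero zero    f≡0 = refl
  sumℚ-zero (suc n) f≡0 = cong₂ _+_ (f≡0 zero) (sumℚ-zero n (f≡0 ∘ suc))

  sumℚ≡sum : ∀ n (f : Fin n → ℚ) → sumℚ n f ≡ sum f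
  sumℚ≡sum zero    f = refl
  sumℚ≡sum (suc n) f = cong (f zero +_) (sumℚ≡sum n (f ∘ suc))

  sumℚ-removeAt : ∀ n (p : Fin (suc n)) (f : Fin (suc n) → ℚ) →
    sumℚ (suc n) f ≡ f p + sumℚ n (removeAt f p)
  sumℚ-removeAt n p f = begin
    sumℚ (suc n) f                ≡⟨ sumℚ≡sum (suc n) f ⟩
    sum f                         ≡⟨ sum-remove f ⟩
    f p + sum (removeAt f p)      ≡⟨ cong (f p +_) (sumℚ≡sum n (removeAt f p)) ⟨
    f p + sumℚ n (removeAt f p)   ∎

  sumℚ-++ : ∀ m n (f : Fin (m ℕ.+ n) → ℚ) →
    sumℚ (m ℕ.+ n) f ≡ sumℚ m (f ∘ (_↑ˡ n)) + sumℚ n (f ∘ (m ↑ʳ_))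
  sumℚ-++ zero    n f = sym (+-identityˡ _)
  sumℚ-++ (suc m) n f = trans (cong (f zero +_) (sumℚ-++ m n (f ∘ suc)))
    (sym (+-assoc (f zero) (sumℚ m (f ∘ suc ∘ (_↑ˡ n))) _))

  0ᵛ : ∀ {n} → Vecℚ n
  0ᵛ _ = 0ℚ

  _·_ : ∀ {n} → ℚ → Vecℚ n → Vecℚ n
  (q · u) i = q * u i

  e : ∀ {n} → Fin n → Vecℚ n
  e j i with j ≟ i
  ... | yes _ = 1ℚ
  ... | no  _ = 0ℚ

  e-diag : ∀ {n} (j : Fin n) → e j j ≡ 1ℚ
  e-diag j with j ≟ j
  ... | yes _   = refl
  ... | no  j≢j = ⊥-elim (j≢j refl)

  e-off : ∀ {n} {j i : Fin n} → j ≢ i → e j i ≡ 0ℚ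
  e-off {j = j} {i} j≢i with j ≟ i
  ... | yes j≡i = ⊥-elim (j≢i j≡i)
  ... | no  _   = refl

  e-sym : ∀ {n} (j i : Fin n) → e j i ≡ e i j
  e-sym j i with j ≟ i | i ≟ j
  ... | yes _   | yes _   = refl
  ... | no  _   | no  _   = refl
  ... | yes j≡i | no  i≢j = ⊥-elim (i≢j (sym j≡i))
  ... | no  j≢i | yes i≡j = ⊥-elim (j≢i (sym i≡j))

  ⟨⟩-congˡ : ∀ {n} {u u′ : Vecℚ n} (x : Vecℚ n) → u ≗ u′ → ⟨ u , x ⟩ ≡ ⟨ u′ , x ⟩
  ⟨⟩-congˡ {n} x u≗u′ = sumℚ-cong n (λ i → cong (_* x i) (u≗u′ i))

  ⟨⟩-congʳ : ∀ {n} (u : Vecℚ n) {x x′ : Vecℚ n} → x ≗ x′ → ⟨ u , x ⟩ ≡ ⟨ u , x′ ⟩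
  ⟨⟩-congʳ {n} u x≗x′ = sumℚ-cong n (λ i → cong (u i *_) (x≗x′ i))

  ⟨⟩-comm : ∀ {n} (u x : Vecℚ n) → ⟨ u , x ⟩ ≡ ⟨ x , u ⟩
  ⟨⟩-comm {n} u x = sumℚ-cong n (λ i → *-comm (u i) (x i))

  ⟨0ᵛ,⟩ : ∀ {n} (x : Vecℚ n) → ⟨ 0ᵛ , x ⟩ ≡ 0ℚ
  ⟨0ᵛ,⟩ {n} x = sumℚ-zero n (λ i → *-zeroˡ (x i))

  ⟨,0ᵛ⟩ : ∀ {n} (u : Vecℚ n) → ⟨ u , 0ᵛ ⟩ ≡ 0ℚ
  ⟨,0ᵛ⟩ {n} u = sumℚ-zero n (λ i → *-zeroʳ (u i))

  ⟨·,⟩ : ∀ {n} q (u x : Vecℚ n) → ⟨ q · u , x ⟩ ≡ q * ⟨ u , x ⟩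
  ⟨·,⟩ {zero}  q u x = sym (*-zeroʳ q)
  ⟨·,⟩ {suc n} q u x = trans (cong (q * u zero * x zero +_) (⟨·,⟩ q (u ∘ suc) (x ∘ suc)))
    (solve 4 (λ q a b s → q :* a :* b :+ q :* s := q :* (a :* b :+ s))
      refl q (u zero) (x zero) ⟨ u ∘ suc , x ∘ suc ⟩)

  ⟨e,⟩ : ∀ {n} (j : Fin n) (x : Vecℚ n) → ⟨ e j , x ⟩ ≡ x j
  ⟨e,⟩ {suc n} j x = begin
    ⟨ e j , x ⟩                                  ≡⟨ sumℚ-removeAt n j (λ i → e j i * x i) ⟩
    e j j * x j + ⟨ removeAt (e j) j , removeAt x j ⟩
      ≡⟨ cong₂ (λ a b → a * x j + b) (e-diag j) off-diagonal ⟩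
    1ℚ * x j + 0ℚ                                ≡⟨ solve 1 (λ a → con 1ℚ :* a :+ con 0ℚ := a) refl (x j) ⟩
    x j                                          ∎
    where
    off-diagonal : ⟨ removeAt (e j) j , removeAt x j ⟩ ≡ 0ℚ
    off-diagonal = trans (⟨⟩-congˡ (removeAt x j) (λ i → e-off (punchInᵢ≢i j i ∘ sym)))
                         (⟨0ᵛ,⟩ (removeAt x j))

  ⟨,e⟩ : ∀ {n} (u : Vecℚ n) (j : Fin n) → ⟨ u , (λ i → e i j) ⟩ ≡ u j
  ⟨,e⟩ u j = trans (⟨⟩-congʳ u (λ i → e-sym i j)) (trans (⟨⟩-comm u (e j)) (⟨e,⟩ j u))

  ⟨·e,⟩ : ∀ {n} q (j : Fin n) (x : Vecℚ n) → ⟨ q · e j , x ⟩ ≡ q * x j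
  ⟨·e,⟩ q j x = trans (⟨·,⟩ q (e j) x) (cong (q *_) (⟨e,⟩ j x))

  ⟨++,⟩ : ∀ {m n} (u : Vecℚ m) (z : Vecℚ n) (x : Vecℚ (m ℕ.+ n)) →
    ⟨ u ++ z , x ⟩ ≡ ⟨ u , x ∘ (_↑ˡ n) ⟩ + ⟨ z , x ∘ (m ↑ʳ_) ⟩
  ⟨++,⟩ {m} {n} u z x = trans (sumℚ-++ m n _)
    (cong₂ _+_ (⟨⟩-congˡ _ (lookup-++ˡ u z)) (⟨⟩-congˡ _ (lookup-++ʳ u z)))

  ⟨,-scaled⟩ : ∀ {n} (c u λs : Vecℚ n) t →
    ⟨ c , (λ i → u i - λs i * t) ⟩ ≡ ⟨ c , u ⟩ - ⟨ c , λs ⟩ * t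
  ⟨,-scaled⟩ {zero}  c u λs t = solve 1 (λ t → con 0ℚ := con 0ℚ :- con 0ℚ :* t) refl t
  ⟨,-scaled⟩ {suc n} c u λs t =
    trans (cong (c zero * (u zero - λs zero * t) +_) (⟨,-scaled⟩ (c ∘ suc) (u ∘ suc) (λs ∘ suc) t))
      (solve 6 (λ c u l t U L → c :* (u :- l :* t) :+ (U :- L :* t) := (c :* u :+ U) :- (c :* l :+ L) :* t)
        refl (c zero) (u zero) (λs zero) t ⟨ c ∘ suc , u ∘ suc ⟩ ⟨ c ∘ suc , λs ∘ suc ⟩)

  nonpos-antisym : ∀ {q} → q ≤ 0ℚ → - q ≤ 0ℚ → q ≡ 0ℚ
  nonpos-antisym {q} q≤0 -q≤0 = ≤-antisym q≤0
    (subst (0ℚ ≤_) (solve 1 (λ q → :- (:- q) := q) refl q) (neg-antimono-≤ -q≤0))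

  -1ℚ : ℚ
  -1ℚ = - 1ℚ

  -1≤0 : -1ℚ ≤ 0ℚ
  -1≤0 = ≤ᵇ⇒≤ tt

  0≤1 : 0ℚ ≤ 1ℚ
  0≤1 = ≤ᵇ⇒≤ tt

  *-cancelʳ-invertible : ∀ {q s s′} → s * s′ ≡ 1ℚ → q * s ≡ 0ℚ → q ≡ 0ℚ
  *-cancelʳ-invertible {q} {s} {s′} ss′≡1 qs≡0 = begin
    q              ≡⟨ *-identityʳ q ⟨
    q * 1ℚ         ≡⟨ cong (q *_) ss′≡1 ⟨
    q * (s * s′)   ≡⟨ *-assoc q s s′ ⟨
    q * s * s′     ≡⟨ cong (_* s′) qs≡0 ⟩
    0ℚ * s′        ≡⟨ *-zeroˡ s′ ⟩
    0ℚ             ∎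

  invertible⇒≢0 : ∀ {s s′} → s * s′ ≡ 1ℚ → s ≢ 0ℚ
  invertible⇒≢0 {s} {s′} ss′≡1 s≡0 =
    1≢0 (*-cancelʳ-invertible {s = s} {s′} ss′≡1 (trans (*-identityˡ s) s≡0))

  LinIndep-eliminate : ∀ {d r} (v : Fin (suc r) → Vecℚ d) (p : Fin (suc r)) (λs : Fin r → ℚ) →
    LinIndep v → LinIndep (λ i j → v (punchIn p i) j - λs i * v p j)
  LinIndep-eliminate {r = r} v p λs indep c′ combo i = begin
    c′ i                 ≡⟨ insertAt-punchIn c′ p s i ⟨
    c (punchIn p i)      ≡⟨ indep c vanishes (punchIn p i) ⟩
    0ℚ                   ∎
    where
    s : ℚ
    s = - ⟨ c′ , λs ⟩
    c : Fin (suc r) → ℚ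
    c = insertAt c′ p s
    vanishes : ∀ j → ⟨ c , (λ k → v k j) ⟩ ≡ 0ℚ
    vanishes j = begin
      ⟨ c , (λ k → v k j) ⟩
        ≡⟨ sumℚ-removeAt r p (λ k → c k * v k j) ⟩
      c p * v p j + ⟨ removeAt c p , (λ i → v (punchIn p i) j) ⟩
        ≡⟨ cong₂ (λ a b → a * v p j + b) (insertAt-lookup c′ p s)
                 (⟨⟩-congˡ _ (removeAt-insertAt c′ p s)) ⟩
      s * v p j + ⟨ c′ , (λ i → v (punchIn p i) j) ⟩
        ≡⟨ solve 3 (λ L t U → (:- L) :* t :+ U := U :- L :* t) refl ⟨ c′ , λs ⟩ (v p j) _ ⟩
      ⟨ c′ , (λ i → v (punchIn p i) j) ⟩ - ⟨ c′ , λs ⟩ * v p j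
        ≡⟨ ⟨,-scaled⟩ c′ (λ i → v (punchIn p i) j) λs (v p j) ⟨
      ⟨ c′ , (λ i → v (punchIn p i) j - λs i * v p j) ⟩
        ≡⟨ combo j ⟩
      0ℚ ∎

  pivot : ∀ {n r} (v : Fin (suc r) → Vecℚ (suc n)) →
    Σ (Fin (suc r)) λ p → Σ (Fin r → ℚ) λ λs → ∀ i → v (punchIn p i) zero - λs i * v p zero ≡ 0ℚ
  pivot {r = r} v with any? (λ p → ¬? (v p zero ≟ℚ 0ℚ))
  ... | yes (p , vp≢0) = p , λs , cleared
    where
    instance
      _ = ≢-nonZero vp≢0
    λs : Fin r → ℚ
    λs i = v (punchIn p i) zero * 1/ v p zero
    cleared : ∀ i → v (punchIn p i) zero - λs i * v p zero ≡ 0ℚ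
    cleared i = begin
      u - u * 1/ α * α     ≡⟨ cong (λ q → u - q) (*-assoc u (1/ α) α) ⟩
      u - u * (1/ α * α)   ≡⟨ cong (λ q → u - u * q) (*-inverseˡ α) ⟩
      u - u * 1ℚ           ≡⟨ solve 1 (λ u → u :- u :* con 1ℚ := con 0ℚ) refl u ⟩
      0ℚ                   ∎
      where
      u = v (punchIn p i) zero
      α = v p zero
  ... | no no-pivot = zero , (λ _ → 0ℚ) , cleared
    where
    cleared : ∀ i → v (suc i) zero - 0ℚ * v zero zero ≡ 0ℚ
    cleared i = begin
      v (suc i) zero - 0ℚ * v zero zero
        ≡⟨ cong (λ q → q - 0ℚ * v zero zero) vᵢ≡0 ⟩
      0ℚ - 0ℚ * v zero zero
        ≡⟨ solve 1 (λ q → con 0ℚ :- con 0ℚ :* q := con 0ℚ) refl (v zero zero) ⟩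
      0ℚ ∎
      where
      vᵢ≡0 : v (suc i) zero ≡ 0ℚ
      vᵢ≡0 = decidable-stable (v (suc i) zero ≟ℚ 0ℚ) (λ ≢0 → no-pivot (suc i , ≢0))

  LinIndep-restrict : ∀ {d n r} (v : Fin r → Vecℚ d) (f : Fin n → Fin d) →
    (∀ j → (∃ λ t → f t ≡ j) ⊎ (∀ i → v i j ≡ 0ℚ)) → LinIndep v → LinIndep (λ i → v i ∘ f)
  LinIndep-restrict {r = r} v f covers indep c combo = indep c vanishes
    where
    vanishes : ∀ j → ⟨ c , (λ i → v i j) ⟩ ≡ 0ℚ
    vanishes j with covers j
    ... | inj₁ (t , refl) = combo t
    ... | inj₂ v≡0        = sumℚ-zero r (λ i → trans (cong (c i *_) (v≡0 i)) (*-zeroʳ (c i)))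

  ¬LinIndep-suc : ∀ n (v : Fin (suc n) → Vecℚ n) → ¬ LinIndep v
  ¬LinIndep-suc zero    v indep = 1≢0 (indep (λ _ → 1ℚ) (λ ()) zero)
  ¬LinIndep-suc (suc n) v indep with pivot v
  ... | p , λs , cleared = ¬LinIndep-suc n (λ i → w i ∘ suc)
          (LinIndep-restrict w suc covers (LinIndep-eliminate v p λs indep))
    where
    w : Fin (suc n) → Vecℚ (suc n)
    w i j = v (punchIn p i) j - λs i * v p j
    covers : ∀ j → (∃ λ t → suc t ≡ j) ⊎ (∀ i → w i j ≡ 0ℚ)
    covers zero    = inj₂ cleared
    covers (suc t) = inj₁ (t , refl)

  DimLt-vanishingʳ : ∀ a m (S : Vecℚ (a ℕ.+ m) → Set) →
    (∀ x → S x → ∀ j → x (a ↑ʳ j) ≡ 0ℚ) → DimLt S (suc a)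
  DimLt-vanishingʳ a m S vanishes (p , p∈S , indep) =
    ¬LinIndep-suc a (λ k → edges k ∘ (_↑ˡ m)) (LinIndep-restrict edges (_↑ˡ m) covers indep)
    where
    edges : Fin (suc a) → Vecℚ (a ℕ.+ m)
    edges k j = p (suc k) j - p zero j
    covers : ∀ j → (∃ λ t → t ↑ˡ m ≡ j) ⊎ (∀ k → edges k j ≡ 0ℚ)
    covers j with splitView a m j
    ... | inl t  = inj₁ (t , refl)
    ... | inr j′ = inj₂ λ k → cong₂ _-_ (vanishes _ (p∈S (suc k)) j′) (vanishes _ (p∈S zero) j′)

module SignedBasis (m : ℕ) where

  open import Data.Rational using (ℚ; 0ℚ; 1ℚ; _*_; -_; _≤_)
  open import Data.Rational.Properties using (*-identityˡ; *-identityʳ; ≤-reflexive; ≤-trans)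
  open import Data.Rational.Solver using (module +-*-Solver)
  open +-*-Solver
  open ≡-Reasoning
  open LinearAlgebra

  axis : Fin (m ℕ.+ m) → Fin m
  axis = _++_ {m = m} id id

  sign : Fin (m ℕ.+ m) → ℚ
  sign = _++_ {m = m} (λ _ → 1ℚ) (λ _ → -1ℚ)

  ±e : Fin (m ℕ.+ m) → Vecℚ m
  ±e ℓ = sign ℓ · e (axis ℓ)

  axis-inl : ∀ (j : Fin m) → axis (j ↑ˡ m) ≡ j
  axis-inl = lookup-++ˡ {m = m} id id

  axis-inr : ∀ (j : Fin m) → axis (m ↑ʳ j) ≡ j
  axis-inr = lookup-++ʳ {m = m} id id

  sign-inl : ∀ (j : Fin m) → sign (j ↑ˡ m) ≡ 1ℚ
  sign-inl = lookup-++ˡ {m = m} (λ _ → 1ℚ) (λ _ → -1ℚ)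

  sign-inr : ∀ (j : Fin m) → sign (m ↑ʳ j) ≡ -1ℚ
  sign-inr = lookup-++ʳ {m = m} (λ _ → 1ℚ) (λ _ → -1ℚ)

  sign-involutive : ∀ (ℓ : Fin (m ℕ.+ m)) → sign ℓ * sign ℓ ≡ 1ℚ
  sign-involutive ℓ with splitView m m ℓ
  ... | inl j = cong₂ _*_ (sign-inl j) (sign-inl j)
  ... | inr j = cong₂ _*_ (sign-inr j) (sign-inr j)

  opposite-signs : ∀ {ℓ ℓ′ : Fin (m ℕ.+ m)} → ℓ ≢ ℓ′ → axis ℓ ≡ axis ℓ′ →
    sign ℓ * sign ℓ′ ≡ -1ℚ
  opposite-signs {ℓ} {ℓ′} ℓ≢ℓ′ same with splitView m m ℓ | splitView m m ℓ′
  ... | inl i | inl j = ⊥-elim (ℓ≢ℓ′ (cong (_↑ˡ m) (trans (sym (axis-inl i)) (trans same (axis-inl j)))))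
  ... | inl i | inr j = cong₂ _*_ (sign-inl i) (sign-inr j)
  ... | inr i | inl j = cong₂ _*_ (sign-inr i) (sign-inl j)
  ... | inr i | inr j = ⊥-elim (ℓ≢ℓ′ (cong (m ↑ʳ_) (trans (sym (axis-inr i)) (trans same (axis-inr j)))))

  ⟨±e,⟩ : ∀ (ℓ : Fin (m ℕ.+ m)) (z : Vecℚ m) → ⟨ ±e ℓ , z ⟩ ≡ sign ℓ * z (axis ℓ)
  ⟨±e,⟩ ℓ = ⟨·e,⟩ (sign ℓ) (axis ℓ)

  ±e-axis : ∀ (ℓ : Fin (m ℕ.+ m)) → ±e ℓ (axis ℓ) ≡ sign ℓ
  ±e-axis ℓ = trans (cong (sign ℓ *_) (e-diag (axis ℓ))) (*-identityʳ (sign ℓ))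

  ⟨±e,±e⟩-self : ∀ (ℓ : Fin (m ℕ.+ m)) → ⟨ ±e ℓ , ±e ℓ ⟩ ≡ 1ℚ
  ⟨±e,±e⟩-self ℓ =
    trans (⟨±e,⟩ ℓ (±e ℓ)) (trans (cong (sign ℓ *_) (±e-axis ℓ)) (sign-involutive ℓ))

  ⟨±e,±e⟩-distinct : ∀ {ℓ ℓ′ : Fin (m ℕ.+ m)} → ℓ ≢ ℓ′ → ⟨ ±e ℓ , ±e ℓ′ ⟩ ≤ 0ℚ
  ⟨±e,±e⟩-distinct {ℓ} {ℓ′} ℓ≢ℓ′ =
    subst (_≤ 0ℚ) (sym (⟨±e,⟩ ℓ (±e ℓ′))) (nonpos (axis ℓ′ ≟ axis ℓ))
    where
    s s′ : ℚ
    s  = sign ℓ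
    s′ = sign ℓ′
    nonpos : Dec (axis ℓ′ ≡ axis ℓ) → s * (s′ * e (axis ℓ′) (axis ℓ)) ≤ 0ℚ
    nonpos (yes same) = subst (_≤ 0ℚ) (sym (begin
      s * (s′ * e (axis ℓ′) (axis ℓ))   ≡⟨ cong (λ j → s * (s′ * e j (axis ℓ))) same ⟩
      s * (s′ * e (axis ℓ) (axis ℓ))    ≡⟨ cong (λ q → s * (s′ * q)) (e-diag (axis ℓ)) ⟩
      s * (s′ * 1ℚ)                     ≡⟨ cong (s *_) (*-identityʳ s′) ⟩
      s * s′                            ≡⟨ opposite-signs ℓ≢ℓ′ (sym same) ⟩
      -1ℚ                               ∎)) -1≤0
    nonpos (no differ) = ≤-reflexive (begin
      s * (s′ * e (axis ℓ′) (axis ℓ))   ≡⟨ cong (λ q → s * (s′ * q)) (e-off differ) ⟩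
      s * (s′ * 0ℚ)                     ≡⟨ solve 2 (λ s s′ → s :* (s′ :* con 0ℚ) := con 0ℚ) refl s s′ ⟩
      0ℚ                                ∎)

  ⟨±e,±e⟩≤1 : ∀ (ℓ ℓ′ : Fin (m ℕ.+ m)) → ⟨ ±e ℓ , ±e ℓ′ ⟩ ≤ 1ℚ
  ⟨±e,±e⟩≤1 ℓ ℓ′ with ℓ ≟ ℓ′
  ... | yes refl = ≤-reflexive (⟨±e,±e⟩-self ℓ)
  ... | no  ℓ≢ℓ′ = ≤-trans (⟨±e,±e⟩-distinct ℓ≢ℓ′) 0≤1

  ±e-polar-trivial : ∀ (z : Vecℚ m) → (∀ ℓ → ⟨ ±e ℓ , z ⟩ ≤ 0ℚ) → ∀ j → z j ≡ 0ℚ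
  ±e-polar-trivial z nonpos j =
    nonpos-antisym (subst (_≤ 0ℚ) at-inl (nonpos (j ↑ˡ m))) (subst (_≤ 0ℚ) at-inr (nonpos (m ↑ʳ j)))
    where
    at-inl : ⟨ ±e (j ↑ˡ m) , z ⟩ ≡ z j
    at-inl = begin
      ⟨ ±e (j ↑ˡ m) , z ⟩                  ≡⟨ ⟨±e,⟩ (j ↑ˡ m) z ⟩
      sign (j ↑ˡ m) * z (axis (j ↑ˡ m))   ≡⟨ cong₂ (λ s a → s * z a) (sign-inl j) (axis-inl j) ⟩
      1ℚ * z j                            ≡⟨ *-identityˡ (z j) ⟩
      z j                                 ∎
    at-inr : ⟨ ±e (m ↑ʳ j) , z ⟩ ≡ - z j
    at-inr = begin
      ⟨ ±e (m ↑ʳ j) , z ⟩                  ≡⟨ ⟨±e,⟩ (m ↑ʳ j) z ⟩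
      sign (m ↑ʳ j) * z (axis (m ↑ʳ j))   ≡⟨ cong₂ (λ s a → s * z a) (sign-inr j) (axis-inr j) ⟩
      -1ℚ * z j                           ≡⟨ solve 1 (λ a → con -1ℚ :* a := :- a) refl (z j) ⟩
      - z j                               ∎

module Construction (a b : ℕ) where

  open import Data.Rational using (ℚ; 0ℚ; 1ℚ; _+_; _*_; -_; _≤_)
  open import Data.Rational.Properties
    using (+-identityˡ; +-identityʳ; *-identityʳ; *-assoc; *-zeroˡ; +-mono-≤; +-monoʳ-≤; ≤-reflexive)
  open import Data.Rational.Solver using (module +-*-Solver)
  open +-*-Solver
  open ≡-Reasoning
  open LinearAlgebra

  m d L P N : ℕ
  m = suc b
  d = a ℕ.+ m
  L = m ℕ.+ m
  P = m ℕ.+ b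
  N = P ℕ.+ a

  open SignedBasis m

  pairVec : Fin L → Vecℚ d
  pairVec ℓ = 0ᵛ ++ ±e ℓ

  coef : Fin (suc L) → ℚ
  coef zero    = -1ℚ
  coef (suc _) = 1ℚ

  coef-involutive : ∀ o → coef o * coef o ≡ 1ℚ
  coef-involutive zero    = refl
  coef-involutive (suc _) = refl

  coef-opposite : ∀ o → coef o * - coef o ≡ -1ℚ
  coef-opposite zero    = refl
  coef-opposite (suc _) = refl

  tailVec : Fin (suc L) → Vecℚ m
  tailVec zero    = 0ᵛ
  tailVec (suc ℓ) = ±e ℓ

  blockVec : Fin a → Fin (suc L) → Vecℚ d
  blockVec t o = (coef o · e t) ++ tailVec o

  pairList : List (Vecℚ d)
  pairList = map pairVec (allFin L)

  blockList : Fin a → List (Vecℚ d)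
  blockList t = map (blockVec t) (allFin (suc L))

  A : Fin N → List (Vecℚ d)
  A = _++_ {m = P} (λ _ → pairList) blockList

  A-inl : ∀ c → A (c ↑ˡ a) ≡ pairList
  A-inl = lookup-++ˡ {m = P} (λ _ → pairList) blockList

  A-inr : ∀ t → A (P ↑ʳ t) ≡ blockList t
  A-inr = lookup-++ʳ {m = P} (λ _ → pairList) blockList

  pairVec∈A : ∀ c ℓ → pairVec ℓ ∈ A (c ↑ˡ a)
  pairVec∈A c ℓ = subst (pairVec ℓ ∈_) (sym (A-inl c)) (∈-map⁺ pairVec (∈-allFin ℓ))

  blockVec∈A : ∀ t o → blockVec t o ∈ A (P ↑ʳ t)
  blockVec∈A t o = subst (blockVec t o ∈_) (sym (A-inr t)) (∈-map⁺ (blockVec t) (∈-allFin o))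

  back : Vecℚ d → Vecℚ m
  back x = x ∘ (a ↑ʳ_)

  ⟨pairVec,⟩ : ∀ ℓ (x : Vecℚ d) → ⟨ pairVec ℓ , x ⟩ ≡ ⟨ ±e ℓ , back x ⟩
  ⟨pairVec,⟩ ℓ x = trans (⟨++,⟩ 0ᵛ (±e ℓ) x)
    (trans (cong (_+ ⟨ ±e ℓ , back x ⟩) (⟨0ᵛ,⟩ (x ∘ (_↑ˡ m)))) (+-identityˡ _))

  ⟨blockVec,⟩ : ∀ t o (x : Vecℚ d) →
    ⟨ blockVec t o , x ⟩ ≡ coef o * x (t ↑ˡ m) + ⟨ tailVec o , back x ⟩
  ⟨blockVec,⟩ t o x = trans (⟨++,⟩ (coef o · e t) (tailVec o) x)
    (cong (_+ ⟨ tailVec o , back x ⟩) (⟨·e,⟩ (coef o) t (x ∘ (_↑ˡ m))))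

  pairVec-nonzero : ∀ ℓ → ¬ IsZeroVec (pairVec ℓ)
  pairVec-nonzero ℓ vanishes = invertible⇒≢0 (sign-involutive ℓ) (begin
    sign ℓ                        ≡⟨ ±e-axis ℓ ⟨
    ±e ℓ (axis ℓ)                 ≡⟨ lookup-++ʳ {m = a} 0ᵛ (±e ℓ) (axis ℓ) ⟨
    pairVec ℓ (a ↑ʳ axis ℓ)       ≡⟨ vanishes (a ↑ʳ axis ℓ) ⟩
    0ℚ                            ∎)

  blockVec-nonzero : ∀ t o → ¬ IsZeroVec (blockVec t o)
  blockVec-nonzero t o vanishes = invertible⇒≢0 (coef-involutive o) (begin
    coef o                        ≡⟨ *-identityʳ (coef o) ⟨
    coef o * 1ℚ                   ≡⟨ cong (coef o *_) (e-diag t) ⟨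
    coef o * e t t                ≡⟨ lookup-++ˡ (coef o · e t) (tailVec o) t ⟨
    blockVec t o (t ↑ˡ m)         ≡⟨ vanishes (t ↑ˡ m) ⟩
    0ℚ                            ∎)

  A-nonzero : ∀ i → All (λ v → ¬ IsZeroVec v) (A i)
  A-nonzero i with splitView P a i
  ... | inl c = subst (All (λ v → ¬ IsZeroVec v)) (sym (A-inl c))
                  (map⁺ (All.universal pairVec-nonzero (allFin L)))
  ... | inr t = subst (All (λ v → ¬ IsZeroVec v)) (sym (A-inr t))
                  (map⁺ (All.universal (blockVec-nonzero t) (allFin (suc L))))

  solutions-vanish : ∀ i (x : Vecℚ d) → SolvesList (A i) x → ∀ j → back x j ≡ 0ℚ
  solutions-vanish i x solves with splitView P a i
  ... | inl c = ±e-polar-trivial (back x) λ ℓ →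
    subst (_≤ 0ℚ) (⟨pairVec,⟩ ℓ x) (solves (pairVec ℓ) (pairVec∈A c ℓ))
  ... | inr t = ±e-polar-trivial (back x) λ ℓ →
    subst (_≤ 0ℚ) (up+down ℓ) (+-mono-≤ (solves-block (suc ℓ)) (solves-block zero))
    where
    solves-block : ∀ o → ⟨ blockVec t o , x ⟩ ≤ 0ℚ
    solves-block o = solves (blockVec t o) (blockVec∈A t o)
    up+down : ∀ ℓ → ⟨ blockVec t (suc ℓ) , x ⟩ + ⟨ blockVec t zero , x ⟩ ≡ ⟨ ±e ℓ , back x ⟩
    up+down ℓ = begin
      ⟨ blockVec t (suc ℓ) , x ⟩ + ⟨ blockVec t zero , x ⟩
        ≡⟨ cong₂ _+_ (⟨blockVec,⟩ t (suc ℓ) x) (⟨blockVec,⟩ t zero x) ⟩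
      (1ℚ * xₜ + ⟨ ±e ℓ , back x ⟩) + (-1ℚ * xₜ + ⟨ 0ᵛ , back x ⟩)
        ≡⟨ cong (λ q → (1ℚ * xₜ + ⟨ ±e ℓ , back x ⟩) + (-1ℚ * xₜ + q)) (⟨0ᵛ,⟩ (back x)) ⟩
      (1ℚ * xₜ + ⟨ ±e ℓ , back x ⟩) + (-1ℚ * xₜ + 0ℚ)
        ≡⟨ solve 2 (λ s w → (con 1ℚ :* s :+ w) :+ (con -1ℚ :* s :+ con 0ℚ) := w) refl xₜ _ ⟩
      ⟨ ±e ℓ , back x ⟩ ∎
      where
      xₜ = x (t ↑ˡ m)

  A-dimension : ∀ i → DimLt (SolvesList (A i)) (suc a)
  A-dimension i = DimLt-vanishingʳ a m _ (solutions-vanish i)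

  module Rainbow (sel : Fin N → Maybe (Vecℚ d)) (rainbow : IsRainbow A sel) where

    pairSlot⊆ : ∀ c v → sel (c ↑ˡ a) ≡ just v → v ∈ pairList
    pairSlot⊆ c v chosen = subst (v ∈_) (A-inl c) (rainbow (c ↑ˡ a) v chosen)

    blockSlot⊆ : ∀ t v → sel (P ↑ʳ t) ≡ just v → v ∈ blockList t
    blockSlot⊆ t v chosen = subst (v ∈_) (A-inr t) (rainbow (P ↑ʳ t) v chosen)

    pairLabel : Fin P → Maybe (Fin L)
    pairLabel c = maybePreimage pairVec (allFin L) (sel (c ↑ˡ a)) (pairSlot⊆ c)

    blockLabel : Fin a → Maybe (Fin (suc L))
    blockLabel t = maybePreimage (blockVec t) (allFin (suc L)) (sel (P ↑ʳ t)) (blockSlot⊆ t)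

    pairLabel-spec : ∀ c v → sel (c ↑ˡ a) ≡ just v → ∃ λ ℓ → pairLabel c ≡ just ℓ × v ≡ pairVec ℓ
    pairLabel-spec c = maybePreimage-spec pairVec (allFin L) (sel (c ↑ˡ a)) (pairSlot⊆ c)

    blockLabel-spec : ∀ t v → sel (P ↑ʳ t) ≡ just v →
      ∃ λ o → blockLabel t ≡ just o × v ≡ blockVec t o
    blockLabel-spec t = maybePreimage-spec (blockVec t) (allFin (suc L)) (sel (P ↑ʳ t)) (blockSlot⊆ t)

    unused : Σ (Fin L) λ ℓ → ∀ c → pairLabel c ≢ just ℓ
    unused = unusedLabel (ℕₚ.+-monoʳ-< m (ℕₚ.n<1+n b)) pairLabel

    ℓ₀ : Fin L
    ℓ₀ = proj₁ unused

    -- The sign 1 for an empty slot is arbitrary: that slot imposes no constraint.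
    σ : Fin a → ℚ
    σ t = maybe (λ o → - coef o) 1ℚ (blockLabel t)

    σ-involutive : ∀ t → σ t * σ t ≡ 1ℚ
    σ-involutive t with blockLabel t
    ... | nothing      = refl
    ... | just zero    = refl
    ... | just (suc _) = refl

    data Selected : Vecℚ d → Set where
      pair  : ∀ ℓ → ℓ ≢ ℓ₀ → Selected (pairVec ℓ)
      block : ∀ t o → σ t ≡ - coef o → Selected (blockVec t o)

    selected : ∀ i v → sel i ≡ just v → Selected v
    selected i v chosen with splitView P a i
    ... | inl c with pairLabel-spec c v chosen
    ...   | ℓ , labelled , refl = pair ℓ λ { refl → proj₂ unused c labelled }
    selected i v chosen | inr t with blockLabel-spec t v chosen
    ...   | o , labelled , refl = block t o (cong (maybe (λ o → - coef o) 1ℚ) labelled)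

    x : Vecℚ d
    x = σ ++ ±e ℓ₀

    y : Fin a → Vecℚ d
    y t = (σ t · e t) ++ 0ᵛ

    solution : Fin (suc a) → Vecℚ d
    solution zero    = x
    solution (suc t) = y t

    ⟨tailVec,±e⟩≤1 : ∀ o → ⟨ tailVec o , ±e ℓ₀ ⟩ ≤ 1ℚ
    ⟨tailVec,±e⟩≤1 zero    = subst (_≤ 1ℚ) (sym (⟨0ᵛ,⟩ (±e ℓ₀))) 0≤1
    ⟨tailVec,±e⟩≤1 (suc ℓ) = ⟨±e,±e⟩≤1 ℓ ℓ₀

    x-solves : ∀ {v} → Selected v → ⟨ v , x ⟩ ≤ 0ℚ
    x-solves (pair ℓ ℓ≢ℓ₀) = subst (_≤ 0ℚ) (sym ⟨pairVec,x⟩) (⟨±e,±e⟩-distinct ℓ≢ℓ₀)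
      where
      ⟨pairVec,x⟩ : ⟨ pairVec ℓ , x ⟩ ≡ ⟨ ±e ℓ , ±e ℓ₀ ⟩
      ⟨pairVec,x⟩ = trans (⟨pairVec,⟩ ℓ x) (⟨⟩-congʳ (±e ℓ) (lookup-++ʳ σ (±e ℓ₀)))
    x-solves (block t o σt≡) = subst (_≤ 0ℚ) (sym ⟨blockVec,x⟩) (+-monoʳ-≤ -1ℚ (⟨tailVec,±e⟩≤1 o))
      where
      ⟨blockVec,x⟩ : ⟨ blockVec t o , x ⟩ ≡ -1ℚ + ⟨ tailVec o , ±e ℓ₀ ⟩
      ⟨blockVec,x⟩ = begin
        ⟨ blockVec t o , x ⟩
          ≡⟨ ⟨blockVec,⟩ t o x ⟩
        coef o * x (t ↑ˡ m) + ⟨ tailVec o , back x ⟩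
          ≡⟨ cong₂ (λ s q → coef o * s + q) (trans (lookup-++ˡ σ (±e ℓ₀) t) σt≡)
                   (⟨⟩-congʳ (tailVec o) (lookup-++ʳ σ (±e ℓ₀))) ⟩
        coef o * - coef o + ⟨ tailVec o , ±e ℓ₀ ⟩
          ≡⟨ cong (_+ ⟨ tailVec o , ±e ℓ₀ ⟩) (coef-opposite o) ⟩
        -1ℚ + ⟨ tailVec o , ±e ℓ₀ ⟩ ∎

    y-solves : ∀ t′ {v} → Selected v → ⟨ v , y t′ ⟩ ≤ 0ℚ
    y-solves t′ (pair ℓ _) = ≤-reflexive (begin
      ⟨ pairVec ℓ , y t′ ⟩             ≡⟨ ⟨pairVec,⟩ ℓ (y t′) ⟩
      ⟨ ±e ℓ , back (y t′) ⟩          ≡⟨ ⟨⟩-congʳ (±e ℓ) (lookup-++ʳ (σ t′ · e t′) 0ᵛ) ⟩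
      ⟨ ±e ℓ , 0ᵛ ⟩                   ≡⟨ ⟨,0ᵛ⟩ (±e ℓ) ⟩
      0ℚ                              ∎)
    y-solves t′ (block t o σt≡) = subst (_≤ 0ℚ) (sym ⟨blockVec,y⟩) (diagonal (t′ ≟ t))
      where
      ⟨blockVec,y⟩ : ⟨ blockVec t o , y t′ ⟩ ≡ coef o * (σ t′ * e t′ t)
      ⟨blockVec,y⟩ = begin
        ⟨ blockVec t o , y t′ ⟩
          ≡⟨ ⟨blockVec,⟩ t o (y t′) ⟩
        coef o * y t′ (t ↑ˡ m) + ⟨ tailVec o , back (y t′) ⟩
          ≡⟨ cong₂ (λ s q → coef o * s + q) (lookup-++ˡ (σ t′ · e t′) 0ᵛ t)
                   (trans (⟨⟩-congʳ (tailVec o) (lookup-++ʳ (σ t′ · e t′) 0ᵛ)) (⟨,0ᵛ⟩ (tailVec o))) ⟩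
        coef o * (σ t′ * e t′ t) + 0ℚ
          ≡⟨ +-identityʳ _ ⟩
        coef o * (σ t′ * e t′ t) ∎
      diagonal : Dec (t′ ≡ t) → coef o * (σ t′ * e t′ t) ≤ 0ℚ
      diagonal (yes refl) = subst (_≤ 0ℚ) (sym (begin
        coef o * (σ t * e t t)    ≡⟨ cong (λ q → coef o * (σ t * q)) (e-diag t) ⟩
        coef o * (σ t * 1ℚ)       ≡⟨ cong (coef o *_) (trans (*-identityʳ (σ t)) σt≡) ⟩
        coef o * - coef o         ≡⟨ coef-opposite o ⟩
        -1ℚ                       ∎)) -1≤0
      diagonal (no t′≢t) = ≤-reflexive (begin
        coef o * (σ t′ * e t′ t)  ≡⟨ cong (λ q → coef o * (σ t′ * q)) (e-off t′≢t) ⟩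
        coef o * (σ t′ * 0ℚ)      ≡⟨ solve 2 (λ s r → s :* (r :* con 0ℚ) := con 0ℚ) refl (coef o) (σ t′) ⟩
        0ℚ                        ∎)

    solution-solves : ∀ k → SolvesSel sel (solution k)
    solution-solves zero    i v chosen = x-solves (selected i v chosen)
    solution-solves (suc t) i v chosen = y-solves t (selected i v chosen)

    -- Only x has a nonzero entry at j₀, and on the first a coordinates the y t are diagonal.
    solution-independent : LinIndep solution
    solution-independent c combo = coefficients
      where
      rest : Fin d → ℚ
      rest j = ⟨ c ∘ suc , (λ t → y t j) ⟩

      j₀ : Fin d
      j₀ = a ↑ʳ axis ℓ₀

      rest-j₀ : rest j₀ ≡ 0ℚ
      rest-j₀ = trans (⟨⟩-congʳ (c ∘ suc) (λ t → lookup-++ʳ (σ t · e t) 0ᵛ (axis ℓ₀))) (⟨,0ᵛ⟩ (c ∘ suc))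

      c₀≡0 : c zero ≡ 0ℚ
      c₀≡0 = *-cancelʳ-invertible (sign-involutive ℓ₀) (begin
        c zero * sign ℓ₀          ≡⟨ cong (c zero *_) (trans (lookup-++ʳ σ (±e ℓ₀) (axis ℓ₀)) (±e-axis ℓ₀)) ⟨
        c zero * x j₀             ≡⟨ +-identityʳ _ ⟨
        c zero * x j₀ + 0ℚ        ≡⟨ cong (c zero * x j₀ +_) rest-j₀ ⟨
        c zero * x j₀ + rest j₀   ≡⟨ combo j₀ ⟩
        0ℚ                        ∎)

      cₜ≡0 : ∀ t → c (suc t) ≡ 0ℚ
      cₜ≡0 t = *-cancelʳ-invertible (σ-involutive t) (begin
        c (suc t) * σ t
          ≡⟨ ⟨,e⟩ (λ t′ → c (suc t′) * σ t′) t ⟨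
        ⟨ (λ t′ → c (suc t′) * σ t′) , (λ t′ → e t′ t) ⟩
          ≡⟨ sumℚ-cong a y-entry ⟩
        rest (t ↑ˡ m)
          ≡⟨ +-identityˡ _ ⟨
        0ℚ + rest (t ↑ˡ m)
          ≡⟨ cong (_+ rest (t ↑ˡ m)) (trans (cong (_* x (t ↑ˡ m)) c₀≡0) (*-zeroˡ (x (t ↑ˡ m)))) ⟨
        c zero * x (t ↑ˡ m) + rest (t ↑ˡ m)
          ≡⟨ combo (t ↑ˡ m) ⟩
        0ℚ ∎)
        where
        y-entry : ∀ t′ → c (suc t′) * σ t′ * e t′ t ≡ c (suc t′) * y t′ (t ↑ˡ m)
        y-entry t′ = trans (*-assoc (c (suc t′)) (σ t′) (e t′ t))
                           (cong (c (suc t′) *_) (sym (lookup-++ˡ (σ t′ · e t′) 0ᵛ t)))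

      coefficients : ∀ k → c k ≡ 0ℚ
      coefficients zero    = c₀≡0
      coefficients (suc t) = cₜ≡0 t

  family : RainbowGapFamily d (suc a) N
  family = A , A-nonzero , A-dimension , λ sel rainbow →
    let open Rainbow sel rainbow in solution , solution-independent , solution-solves

open import Data.Nat using (_+_; _∸_; _≤_; _<_; s≤s; z≤n)

corollary5p4 : (d k : ℕ) → 2 ≤ d → 1 ≤ k → k < d →
    Σ (Fin (d + (d ∸ k)) → List (Vecℚ d)) λ A →
      ((i : Fin (d + (d ∸ k))) → All (λ a → ¬ IsZeroVec a) (A i))
      × ((i : Fin (d + (d ∸ k))) → DimLt (SolvesList (A i)) k)
      × ((sel : Fin (d + (d ∸ k)) → Maybe (Vecℚ d)) → IsRainbow A sel →
           Σ (Fin k → Vecℚ d) λ v → LinIndep v × ((i : Fin k) → SolvesSel sel (v i)))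
-- The construction only needs 1 ≤ k ≤ d.
corollary5p4 d (suc a) _ (s≤s z≤n) k<d with ℕₚ.m≤n⇒∃[o]m+o≡n (ℕₚ.<⇒≤ k<d)
... | b , refl = subst₂ (λ d N → RainbowGapFamily d (suc a) N) (ℕₚ.+-suc a b) N≡ (Construction.family a b)
  where
  N≡ : suc b + b + a ≡ (suc a + b) + (suc a + b ∸ suc a)
  N≡ = begin
    suc b + b + a                      ≡⟨ cong suc (trans (ℕₚ.+-comm (b + b) a) (sym (ℕₚ.+-assoc a b b))) ⟩
    suc a + b + b                      ≡⟨ cong (suc a + b +_) (ℕₚ.m+n∸m≡n a b) ⟨
    (suc a + b) + (suc a + b ∸ suc a)  ∎
    where open ≡-Reasoning
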